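{- The following problem is decidable: given a non-deterministic register transducer $T$ defining a function $f$, a finite data word $u\in(\Sigma\times\mathcal{D})^*$ and a finite data word $v\in(\Gamma\times\mathcal{D})^*$, decide whether $v\preceq\hat{f}(u)$.
   Context: Fix finite alphabets $\Sigma,\Gamma$, a countably infinite set $\mathcal{D}$ of data values with an effective representation (e.g. $\mathcal{D}=\mathbb{N}$) and a distinguished $d_0\in\mathcal{D}$. A test over a finite register set $R$ is a Boolean combination of $\top,\bot,r^{=},r^{\neq}$ ($r\in R$); for $\tau:R\to\mathcal{D}$ and $d\in\mathcal{D}$, $\tau,d\models r^{=}$ iff $\tau(r)=d$, $\tau,d\models r^{\neq}$ iff $\tau(r)\neq d$. A non-deterministic register transducer (NRT) is $T=(Q,R,i_0,F,\Delta)$ with finite states $Q$, initial $i_0$, accepting $F\subseteq Q$, finite register set $R$, and finite $\Delta\subseteq Q\times\Sigma\times\mathrm{Tests}_R\times2^R\times(\Gamma\times R)^*\times Q$. From configuration $(q,\tau)$, reading $(\sigma,d)$, a transition $(q,\sigma,\phi,\mathrm{asgn},o,q')$ with $\tau,d\models\phi$ leads to $(q',\tau')$ with $\tau'(r)=d$ if $r\in\mathrm{asgn}$ and $\tau'(r)=\tau(r)$ otherwise, outputting $(\gamma_1,\tau'(r_1))\cdots(\gamma_m,\tau'(r_m))$ where $o=(\gamma_1,r_1)\cdots(\gamma_m,r_m)$. An accepting run starts in $i_0$ with all registers equal to $d_0$ and visits $F$ infinitely often; standing assumption: accepting runs produce infinite outputs. $T$ defines the function $f$ if the set of (input, output) pairs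 of accepting runs is the graph of the partial function $f:(\Sigma\times\mathcal{D})^\omega\to(\Gamma\times\mathcal{D})^\omega$. $\preceq$ is the prefix order. For a finite word $u$ that is a prefix of some word in $\mathrm{dom}(f)$, $\hat f(u)$ is the longest common prefix of all words $f(uy)$ with $uy\in\mathrm{dom}(f)$. -}

module Defs where

open import Data.Nat using (ℕ; zero; suc; _≤_)
open import Data.Fin using (Fin; toℕ)
open import Data.Bool using (Bool; true; false; if_then_else_)
open import Data.List using (List; []; _∷_; _++_; length; map; lookup)
open import Data.List.Membership.Propositional using (_∈_)
open import Data.Product using (_×_; _,_; Σ; ∃; proj₁; proj₂)
open import Data.Sum using (_⊎_)
open import Data.Empty using (⊥)
open import Data.Unit using (⊤)
open import Relation.Binary.PropositionalEquality using (_≡_; _≢_)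
open import Relation.Nullary using (¬_)

-- Data values: 𝒟 = ℕ (effective representation).
Data : Set
Data = ℕ

ω-Word : Set → Set
ω-Word A = ℕ → A

_⪯_ : {A : Set} → List A → ω-Word A → Set
v ⪯ w = (i : Fin (length v)) → w (toℕ i) ≡ lookup v i

data Test (nR : ℕ) : Set where
  tt ff     : Test nR
  req rneq  : Fin nR → Test nR
  ¬t        : Test nR → Test nR
  _∧t_ _∨t_ : Test nR → Test nR → Test nR

Valuation : ℕ → Set
Valuation nR = Fin nR → Data

_,_⊨_ : {nR : ℕ} → Valuation nR → Data → Test nR → Set
τ , d ⊨ tt = ⊤
τ , d ⊨ ff = ⊥
τ , d ⊨ req r = τ r ≡ d
τ , d ⊨ rneq r = τ r ≢ d
τ , d ⊨ ¬t φ = ¬ (τ , d ⊨ φ)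
τ , d ⊨ (φ ∧t ψ) = (τ , d ⊨ φ) × (τ , d ⊨ ψ)
τ , d ⊨ (φ ∨t ψ) = (τ , d ⊨ φ) ⊎ (τ , d ⊨ ψ)

-- Transitions (q, σ, φ, asgn, o, q') with Σ = Fin nΣ, Γ = Fin nΓ, Q = Fin nQ, R = Fin nR.
record Transition (nΣ nΓ nQ nR : ℕ) : Set where
  constructor trans
  field
    src  : Fin nQ
    lab  : Fin nΣ
    test : Test nR
    asgn : Fin nR → Bool          -- the subset asgn ⊆ R
    out  : List (Fin nΓ × Fin nR)
    tgt  : Fin nQ

record NRT (nΣ nΓ : ℕ) : Set where
  constructor nrt
  field
    nQ  : ℕ
    nR  : ℕ
    i₀  : Fin nQ
    F   : Fin nQ → Bool
    Δ   : List (Transition nΣ nΓ nQ nR)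

module _ {nΣ nΓ : ℕ} (T : NRT nΣ nΓ) where
  open NRT T

  update : (Fin nR → Bool) → Valuation nR → Data → Valuation nR
  update a τ d r = if a r then d else τ r

  evalOut : List (Fin nΓ × Fin nR) → Valuation nR → List (Fin nΓ × Data)
  evalOut o τ' = map (λ p → proj₁ p , τ' (proj₂ p)) o

  record Run (x : ω-Word (Fin nΣ × Data)) : Set where
    field
      state : ℕ → Fin nQ
      regs  : ℕ → Valuation nR
      tr    : ℕ → Transition nΣ nΓ nQ nR
      tr∈Δ  : ∀ i → tr i ∈ Δ
      src≡  : ∀ i → Transition.src (tr i) ≡ state i
      tgt≡  : ∀ i → Transition.tgt (tr i) ≡ state (suc i)
      lab≡  : ∀ i → Transition.lab (tr i) ≡ proj₁ (x i)
      sat   : ∀ i → regs i , proj₂ (x i) ⊨ Transition.test (tr i)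
      upd   : ∀ i r → regs (suc i) r
                      ≡ update (Transition.asgn (tr i)) (regs i) (proj₂ (x i)) r

    outUpTo : ℕ → List (Fin nΓ × Data)
    outUpTo zero = []
    outUpTo (suc n) = outUpTo n ++ evalOut (Transition.out (tr n)) (regs (suc n))

  open Run public

  Accepting : (d₀ : Data) → {x : ω-Word (Fin nΣ × Data)} → Run x → Set
  Accepting d₀ ρ =
    (state ρ 0 ≡ i₀) × (∀ r → regs ρ 0 r ≡ d₀) ×
    (∀ n → Σ ℕ λ m → n ≤ m × F (state ρ m) ≡ true)

  -- Standing assumption: accepting runs produce infinite outputs.
  InfiniteOutputs : Data → Set
  InfiniteOutputs d₀ = ∀ x (ρ : Run x) → Accepting d₀ ρ →
    ∀ k → Σ ℕ λ n → k ≤ length (outUpTo ρ n)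

  OutputOf : {x : ω-Word (Fin nΣ × Data)} → Run x → ω-Word (Fin nΓ × Data) → Set
  OutputOf ρ w = ∀ n → outUpTo ρ n ⪯ w

  Rel : Data → ω-Word (Fin nΣ × Data) → ω-Word (Fin nΓ × Data) → Set
  Rel d₀ x w = Σ (Run x) λ ρ → Accepting d₀ ρ × OutputOf ρ w

  -- T defines a (partial) function: the relation is functional
  -- (infinite words compared pointwise).
  Functional : Data → Set
  Functional d₀ = ∀ x w w′ → Rel d₀ x w → Rel d₀ x w′ → ∀ n → w n ≡ w′ n

  PrefixOfDom : Data → List (Fin nΣ × Data) → Set
  PrefixOfDom d₀ u = Σ (ω-Word (Fin nΣ × Data)) λ x →
    Σ (ω-Word (Fin nΓ × Data)) λ w → Rel d₀ x w × (u ⪯ x)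

  -- v ⪯ f̂(u): f̂(u) is the longest common prefix of {f(uy) | uy ∈ dom f},
  -- so v ⪯ f̂(u) iff v is a common prefix of all f(uy), uy ∈ dom f.
  PrefixOfHat : Data → List (Fin nΣ × Data) → List (Fin nΓ × Data) → Set
  PrefixOfHat d₀ u v = ∀ x w → Rel d₀ x w → u ⪯ x → v ⪯ w

module Submission where

-- v ⪯ f̂(u) fails iff some accepting run of T on an input x extending u has
-- an output conflicting with v at some position.  All data values that
-- matter (d₀ and those of u and v) lie below a bound M; renaming every other
-- value, consistently with the register contents, to a fresh value in
-- [M, M + nR] turns any such counterexample into one whose data all lie
-- below K = M + nR + 1.  Such bounded counterexamples are exactly the
-- Büchi runs of a finite graph whose nodes track the progress in u, the
-- state of a deterministic prefix checker for v, the control state and the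
-- registers.  Büchi emptiness of finite graphs is decidable (lassos of
-- bounded size), which decides the problem.

open import Defs hiding (trans)
open import Data.Nat using (ℕ; zero; suc; _+_; _∸_; _≤_; _<_; _⊓_; _⊔_; _≤′_; ≤′-reflexive; ≤′-step; z≤n; s≤s)
open import Data.Nat.Properties
open import Data.Fin using (Fin; toℕ; fromℕ<) renaming (zero to fzero; suc to fsuc)
open import Data.Fin.Properties using (toℕ<n; toℕ-fromℕ<; pigeonhole) renaming (_≟_ to _≟F_; any? to anyFin?)
open import Data.Bool using (Bool; true; false; if_then_else_)
open import Data.Bool.Properties using (if-float) renaming (_≟_ to _≟B_)
open import Data.Maybe using (Maybe; just; nothing)
open import Data.Maybe.Properties using (just-injective) renaming (≡-dec to ≡-decMaybe)
open import Data.List using (List; []; _∷_; length; lookup; foldl; _++_; map; cartesianProduct; cartesianProductWith; allFin)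
open import Data.List.Properties using (foldl-++; map-cong; ++-identityʳ; ++-assoc)
open import Data.List.Membership.Propositional using (_∈_; find; lose)
open import Data.List.Membership.Propositional.Properties using (∈-allFin; ∈-cartesianProduct⁺; ∈-cartesianProductWith⁺)
open import Data.List.Relation.Unary.Any using (Any; here; any?; index)
open import Data.List.Relation.Unary.Any.Properties using (lookup-index)
open import Data.Vec using (Vec; tabulate) renaming ([] to []ᵛ; _∷_ to _∷ᵛ_; lookup to lookupᵛ)
open import Data.Vec.Properties using (lookup∘tabulate; tabulate-cong) renaming (≡-dec to ≡-decVec)
open import Data.Product using (_×_; _,_; Σ; proj₁; proj₂)
open import Data.Product.Properties using () renaming (≡-dec to ≡-dec×)
open import Data.Sum using (inj₁; inj₂) renaming (map to ⊎-map)
open import Data.Empty using (⊥-elim)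
open import Data.Unit using (tt)
open import Function.Bundles using (mk⇔)
open import Relation.Binary.PropositionalEquality
open import Relation.Binary.Definitions using (DecidableEquality)
open import Relation.Nullary using (Dec; yes; no; ¬_; does)
open import Relation.Nullary.Decidable using (map′; _×-dec_; _⊎-dec_; _→-dec_; ¬?; does-⇔; decidable-stable)

_!_ : ∀ {A : Set} → List A → ℕ → Maybe A
[] ! _ = nothing
(a ∷ l) ! zero = just a
(a ∷ l) ! suc n = l ! n

!-lookup : ∀ {A : Set} (l : List A) (i : Fin (length l)) → l ! toℕ i ≡ just (lookup l i)
!-lookup (a ∷ l) fzero = refl
!-lookup (a ∷ l) (fsuc i) = !-lookup l i

!-just : ∀ {A : Set} (l : List A) {j a} → l ! j ≡ just a → Σ (Fin (length l)) λ i → toℕ i ≡ j × lookup l i ≡ a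
!-just (b ∷ l) {zero} refl = fzero , refl , refl
!-just (b ∷ l) {suc j} e = let (i , p , q) = !-just l e in fsuc i , cong suc p , q

!-in-range : ∀ {A : Set} (l : List A) {j a} → l ! j ≡ just a → j < length l
!-in-range l e = let (i , p , _) = !-just l e in subst (_< length l) p (toℕ<n i)

!-defined : ∀ {A : Set} (l : List A) {j} → j < length l → Σ A λ a → l ! j ≡ just a
!-defined (a ∷ l) {zero} _ = a , refl
!-defined (a ∷ l) {suc j} (s≤s h) = !-defined l h

!-out-of-range : ∀ {A : Set} (l : List A) {j} → length l ≤ j → l ! j ≡ nothing
!-out-of-range [] h = refl
!-out-of-range (a ∷ l) {suc j} (s≤s h) = !-out-of-range l h

!-++ : ∀ {A : Set} (l e : List A) {j a} → l ! j ≡ just a → (l ++ e) ! j ≡ just a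
!-++ (b ∷ l) e {zero} h = h
!-++ (b ∷ l) e {suc j} h = !-++ l e h

dataSum : ∀ {A : Set} → List (A × ℕ) → ℕ
dataSum [] = 0
dataSum ((a , d) ∷ l) = d + dataSum l

!-dataSum : ∀ {A : Set} (l : List (A × ℕ)) {j a} → l ! j ≡ just a → proj₂ a ≤ dataSum l
!-dataSum ((b , d) ∷ l) {zero} refl = m≤m+n d (dataSum l)
!-dataSum ((b , d) ∷ l) {suc j} e = ≤-trans (!-dataSum l e) (m≤n+m (dataSum l) d)

-- Büchi emptiness for a finite graph with decidable edges and acceptance:
-- an infinite path from `start` visiting accepting nodes infinitely often
-- exists iff there is a lasso (a path to an accepting node s plus a cycle
-- through s), and lassos can be searched for because every path can be
-- shortened to one of length at most the number of nodes.
module BuchiEmptiness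
  {Node : Set} (_≟N_ : DecidableEquality Node)
  (nodes : List Node) (complete : ∀ s → s ∈ nodes)
  (Edge : Node → Node → Set) (edge? : ∀ s t → Dec (Edge s t))
  (Acc : Node → Set) (acc? : ∀ s → Dec (Acc s))
  (start : Node) where

  N : ℕ
  N = length nodes

  code : Node → Fin N
  code s = index (complete s)

  code-injective : ∀ {s t} → code s ≡ code t → s ≡ t
  code-injective {s} {t} eq = begin
    s                     ≡⟨ lookup-index (complete s) ⟩
    lookup nodes (code s) ≡⟨ cong (lookup nodes) eq ⟩
    lookup nodes (code t) ≡⟨ lookup-index (complete t) ⟨
    t                     ∎
    where open ≡-Reasoning

  exists? : {P : Node → Set} → (∀ s → Dec (P s)) → Dec (Σ Node P)
  exists? P? = map′ (λ p → let (s , _ , ps) = find p in s , ps)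
                    (λ (s , ps) → lose (complete s) ps) (any? P? nodes)

  data Path : Node → Node → Set where
    []  : ∀ {a} → Path a a
    _∷_ : ∀ {a b c} → Edge a b → Path b c → Path a c

  len : ∀ {a b} → Path a b → ℕ
  len [] = 0
  len (e ∷ p) = suc (len p)

  _++ᴾ_ : ∀ {a b c} → Path a b → Path b c → Path a c
  [] ++ᴾ q = q
  (e ∷ p) ++ᴾ q = e ∷ (p ++ᴾ q)

  len-++ᴾ : ∀ {a b c} (p : Path a b) (q : Path b c) → len (p ++ᴾ q) ≡ len p + len q
  len-++ᴾ [] q = refl
  len-++ᴾ (e ∷ p) q = cong suc (len-++ᴾ p q)

  reroute : ∀ {a a′ b b′} → a ≡ a′ → b ≡ b′ → (p : Path a b) → Σ (Path a′ b′) λ q → len q ≡ len p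
  reroute refl refl p = p , refl

  PathWithin : ℕ → Node → Node → Set
  PathWithin k a b = Σ (Path a b) λ p → len p ≤ k

  pathWithin? : ∀ k a b → Dec (PathWithin k a b)
  pathWithin? k a b with a ≟N b
  ... | yes refl = yes ([] , z≤n)
  pathWithin? zero a b | no a≢b = no λ { ([] , _) → a≢b refl ; ((e ∷ p) , ()) }
  pathWithin? (suc k) a b | no a≢b with exists? (λ s → edge? a s ×-dec pathWithin? k s b)
  ... | yes (s , e , p , l) = yes (e ∷ p , s≤s l)
  ... | no ¬step = no λ { ([] , _) → a≢b refl ; ((e ∷ p) , s≤s l) → ¬step (_ , e , p , l) }

  nodeAt : ∀ {a b} (p : Path a b) → Fin (suc (len p)) → Node
  nodeAt {a} p fzero = a
  nodeAt (e ∷ p) (fsuc i) = nodeAt p i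

  prefixTo : ∀ {a b} (p : Path a b) (i : Fin (suc (len p))) → Σ (Path a (nodeAt p i)) λ q → len q ≡ toℕ i
  prefixTo p fzero = [] , refl
  prefixTo (e ∷ p) (fsuc i) = let (q , l) = prefixTo p i in e ∷ q , cong suc l

  suffixFrom : ∀ {a b} (p : Path a b) (i : Fin (suc (len p))) → Σ (Path (nodeAt p i) b) λ q → len q ≡ len p ∸ toℕ i
  suffixFrom p fzero = p , refl
  suffixFrom (e ∷ p) (fsuc i) = suffixFrom p i

  -- A path visiting more than N nodes repeats one (pigeonhole); cutting out
  -- the cycle between the two visits gives a strictly shorter path.
  cutCycle : ∀ {a b} (p : Path a b) → N < suc (len p) → Σ (Path a b) λ q → len q < len p
  cutCycle p N<
    with i , j , i<j , same ← pigeonhole N< (λ k → code (nodeAt p k))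
    with front , |front| ← prefixTo p i
       | back , |back| ← suffixFrom p j
    with back′ , |back′| ← reroute (code-injective (sym same)) refl back
    = front ++ᴾ back′ , shorter
    where
    open ≤-Reasoning
    shorter : len (front ++ᴾ back′) < len p
    shorter = begin-strict
      len (front ++ᴾ back′)   ≡⟨ len-++ᴾ front back′ ⟩
      len front + len back′   ≡⟨ cong₂ _+_ |front| (trans |back′| |back|) ⟩
      toℕ i + (len p ∸ toℕ j) <⟨ +-monoˡ-< (len p ∸ toℕ j) i<j ⟩
      toℕ j + (len p ∸ toℕ j) ≡⟨ m+[n∸m]≡n (≤-pred (toℕ<n j)) ⟩
      len p                   ∎

  -- Repeated cycle removal, with fuel k bounding the length.
  shortenWithin : ∀ {a b} k (p : Path a b) → len p ≤ k → PathWithin N a b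
  shortenWithin k p p≤k with len p ≤? N
  ... | yes p≤N = p , p≤N
  shortenWithin zero p p≤0 | no p≰N = ⊥-elim (p≰N (≤-trans p≤0 z≤n))
  shortenWithin (suc k) p p≤k | no p≰N =
    let (q , q<p) = cutCycle p (m<n⇒m<1+n (≰⇒> p≰N)) in shortenWithin k q (≤-pred (≤-trans q<p p≤k))

  path? : ∀ a b → Dec (Path a b)
  path? a b = map′ proj₁ (λ p → shortenWithin (len p) p ≤-refl) (pathWithin? N a b)

  record BuchiRun : Set where
    field
      node      : ℕ → Node
      starts    : node 0 ≡ start
      steps     : ∀ i → Edge (node i) (node (suc i))
      recurrent : ∀ n → Σ ℕ λ m → n ≤ m × Acc (node m)

  record Lasso : Set where
    field
      knot      : Node
      accepting : Acc knot
      stem      : Path start knot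
      next      : Node
      exit      : Edge knot next
      loop      : Path next knot

  lasso? : Dec Lasso
  lasso? = map′ (λ (s , a , p , t , e , q) → record { knot = s ; accepting = a ; stem = p ; next = t ; exit = e ; loop = q })
                (λ l → let open Lasso l in knot , accepting , stem , next , exit , loop)
                (exists? λ s → acc? s ×-dec path? start s ×-dec exists? λ t → edge? s t ×-dec path? t s)

  -- Unrolling a lasso: follow the stem, then go round the cycle forever.
  -- The walk is driven by a cursor holding the remaining path to the knot.
  module Unroll {s t : Node} (exit : Edge s t) (loop : Path t s) where
    Cursor : Set
    Cursor = Σ Node λ a → Path a s

    advance : Cursor → Cursor
    advance (a , e ∷ p) = _ , p
    advance (a , []) = t , loop

    advance-edge : (c : Cursor) → Edge (proj₁ c) (proj₁ (advance c))
    advance-edge (a , e ∷ p) = e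
    advance-edge (a , []) = exit

    walk : ℕ → Cursor → Cursor
    walk zero c = c
    walk (suc n) c = advance (walk n c)

    walk-suc : ∀ n c → walk (suc n) c ≡ walk n (advance c)
    walk-suc zero c = refl
    walk-suc (suc n) c = cong advance (walk-suc n c)

    walk-+ : ∀ k n c → walk (k + n) c ≡ walk k (walk n c)
    walk-+ zero n c = refl
    walk-+ (suc k) n c = cong advance (walk-+ k n c)

    reaches-knot : ∀ a (p : Path a s) → proj₁ (walk (len p) (a , p)) ≡ s
    reaches-knot a [] = refl
    reaches-knot a (e ∷ p) = trans (cong proj₁ (walk-suc (len p) (a , e ∷ p))) (reaches-knot _ p)

  -- The knot is revisited whenever the cursor's remaining path is used up.
  unroll : Lasso → BuchiRun
  unroll l = record { node = node ; starts = refl ; steps = λ i → advance-edge (walk i origin) ; recurrent = recurrent }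
    where
    open Lasso l
    open Unroll exit loop
    origin : Cursor
    origin = start , stem
    node : ℕ → Node
    node i = proj₁ (walk i origin)
    recurrent : ∀ n → Σ ℕ λ m → n ≤ m × Acc (node m)
    recurrent n =
      let (a , p) = walk n origin
          atKnot = trans (cong proj₁ (walk-+ (len p) n origin)) (reaches-knot a p)
      in len p + n , m≤n+m n (len p) , subst Acc (sym atKnot) accepting

  -- Folding a Büchi run into a lasso: among N+1 accepting visits two are at
  -- the same node (pigeonhole); the run between them is the cycle.
  module Fold (run : BuchiRun) where
    open BuchiRun run

    visit : ℕ → ℕ
    visit zero = proj₁ (recurrent 0)
    visit (suc k) = proj₁ (recurrent (suc (visit k)))

    visit-accepting : ∀ k → Acc (node (visit k))
    visit-accepting zero = proj₂ (proj₂ (recurrent 0))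
    visit-accepting (suc k) = proj₂ (proj₂ (recurrent (suc (visit k))))

    visit-increasing : ∀ {k l} → suc k ≤′ l → visit k < visit l
    visit-increasing {k} (≤′-reflexive refl) = proj₁ (proj₂ (recurrent (suc (visit k))))
    visit-increasing (≤′-step k<l) = <-trans (visit-increasing k<l) (proj₁ (proj₂ (recurrent _)))

    segment : ∀ {a b} → a ≤′ b → Path (node a) (node b)
    segment (≤′-reflexive refl) = []
    segment (≤′-step {b} a≤b) = segment a≤b ++ᴾ (steps b ∷ [])

    lasso : Lasso
    lasso with i , j , i<j , same ← pigeonhole (n<1+n N) (λ k → code (node (visit (toℕ k))))
      = record
      { knot = node a ; accepting = visit-accepting (toℕ i)
      ; stem = proj₁ (reroute starts refl (segment (≤⇒≤′ z≤n)))
      ; next = node (suc a) ; exit = steps a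
      ; loop = proj₁ (reroute refl (code-injective (sym same)) (segment (≤⇒≤′ a<b))) }
      where
      a : ℕ
      a = visit (toℕ i)
      a<b : a < visit (toℕ j)
      a<b = visit-increasing (≤⇒≤′ i<j)

  buchi? : Dec BuchiRun
  buchi? = map′ unroll Fold.lasso lasso?

-- A deterministic automaton checking that a finite word w extends to one
-- with prefix v, i.e. that w and v agree on their common positions.  State
-- c ≤ |v| counts the letters of v matched so far; `rejected` records a mismatch.
module PrefixChecker {A : Set} (_≟_ : DecidableEquality A) (v : List A) where

  rejected : ℕ
  rejected = suc (length v)

  scan : ℕ → A → ℕ
  scan c a with v ! c
  ... | nothing = c
  ... | just b = if does (a ≟ b) then suc c else rejected

  check : List A → ℕ
  check = foldl scan 0

  matched-stable : ∀ c l → v ! c ≡ nothing → foldl scan c l ≡ c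
  matched-stable c [] e = refl
  matched-stable c (a ∷ l) e rewrite e = matched-stable c l e

  rejected-absorbing : ∀ l → foldl scan rejected l ≡ rejected
  rejected-absorbing l = matched-stable rejected l (!-out-of-range v (n≤1+n _))

  state-bounded : ∀ c l → c ≤ rejected → foldl scan c l ≤ rejected
  state-bounded c [] h = h
  state-bounded c (a ∷ l) h with v ! c in eq
  ... | nothing = state-bounded c l h
  ... | just b with does (a ≟ b)
  ... | true = state-bounded (suc c) l (s≤s (<⇒≤ (!-in-range v eq)))
  ... | false = state-bounded rejected l ≤-refl

  conflict⇒rejected : ∀ l c j {a b} → l ! j ≡ just a → v ! (j + c) ≡ just b → a ≢ b →
                      foldl scan c l ≡ rejected
  conflict⇒rejected (a′ ∷ l) c zero {a} {b} refl vb a≢b with v ! c | vb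
  ... | just .b | refl with a′ ≟ b
  ... | yes a≡b = ⊥-elim (a≢b a≡b)
  ... | no _ = rejected-absorbing l
  conflict⇒rejected (a′ ∷ l) c (suc j) la vb a≢b
    with v ! c | !-defined v {c} (≤-trans (s≤s (m≤n+m c (suc j))) (!-in-range v vb))
  ... | just b′ | .b′ , refl with does (a′ ≟ b′)
  ... | true = conflict⇒rejected l (suc c) j la (trans (cong (v !_) (+-suc j c)) vb) a≢b
  ... | false = rejected-absorbing l

  rejected⇒conflict : ∀ l c → c ≤ length v → foldl scan c l ≡ rejected →
    Σ ℕ λ j → Σ A λ a → Σ A λ b → l ! j ≡ just a × v ! (j + c) ≡ just b × a ≢ b
  rejected⇒conflict [] c h e = ⊥-elim (<⇒≱ (s≤s h) (≤-reflexive (sym e)))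
  rejected⇒conflict (a ∷ l) c h e with v ! c in eq
  ... | nothing = ⊥-elim (<⇒≱ (s≤s h) (≤-reflexive (trans (sym e) (matched-stable c l eq))))
  ... | just b with a ≟ b
  ... | no a≢b = 0 , a , b , refl , eq , a≢b
  ... | yes _ with rejected⇒conflict l (suc c) (!-in-range v eq) e
  ... | j , a′ , b′ , la , vb , a′≢b′ = suc j , a′ , b′ , la , trans (cong (v !_) (sym (+-suc j c))) vb , a′≢b′

  Indistinguishable : A → A → Set
  Indistinguishable a a′ = ∀ {j b} → v ! j ≡ just b → (a ≡ b → a′ ≡ b) × (a′ ≡ b → a ≡ b)

  scan-respects : ∀ c {a a′} → Indistinguishable a a′ → scan c a ≡ scan c a′
  scan-respects c {a} {a′} indist with v ! c in eq
  ... | nothing = refl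
  ... | just b = let (to , from) = indist eq in
    cong (if_then suc c else rejected) (does-⇔ (mk⇔ to from) (a ≟ b) (a′ ≟ b))

  run-respects : ∀ {B : Set} (f g : B → A) → (∀ x → Indistinguishable (f x) (g x)) →
                 ∀ c l → foldl scan c (map f l) ≡ foldl scan c (map g l)
  run-respects f g indist c [] = refl
  run-respects f g indist c (x ∷ l)
    rewrite scan-respects c (indist x) = run-respects f g indist (scan c (g x)) l

record Agrees {nR : ℕ} (τ τ′ : Valuation nR) (d d′ : Data) : Set where
  field
    forth : ∀ r → τ r ≡ d → τ′ r ≡ d′
    back  : ∀ r → τ′ r ≡ d′ → τ r ≡ d
open Agrees

-- Agreement is symmetric (needed to transfer negated tests) ...
agrees-sym : ∀ {nR} {τ τ′ : Valuation nR} {d d′} → Agrees τ τ′ d d′ → Agrees τ′ τ d′ d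
agrees-sym a = record { forth = back a ; back = forth a }

agrees-≗ : ∀ {nR} {τ τ′ : Valuation nR} {d d′} → (∀ r → τ r ≡ τ′ r) → d ≡ d′ → Agrees τ τ′ d d′
agrees-≗ τ≗τ′ refl = record { forth = λ r e → trans (sym (τ≗τ′ r)) e ; back = λ r e → trans (τ≗τ′ r) e }

⊨? : ∀ {nR} (τ : Valuation nR) d φ → Dec (τ , d ⊨ φ)
⊨? τ d tt = yes tt
⊨? τ d ff = no λ ()
⊨? τ d (req r) = τ r ≟ d
⊨? τ d (rneq r) = ¬? (τ r ≟ d)
⊨? τ d (¬t φ) = ¬? (⊨? τ d φ)
⊨? τ d (φ ∧t ψ) = ⊨? τ d φ ×-dec ⊨? τ d ψ
⊨? τ d (φ ∨t ψ) = ⊨? τ d φ ⊎-dec ⊨? τ d ψ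

⊨-transfer : ∀ {nR} {τ τ′ : Valuation nR} {d d′} → Agrees τ τ′ d d′ → ∀ φ → τ , d ⊨ φ → τ′ , d′ ⊨ φ
⊨-transfer a tt h = h
⊨-transfer a ff ()
⊨-transfer a (req r) h = forth a r h
⊨-transfer a (rneq r) h e = h (back a r e)
⊨-transfer a (¬t φ) h h′ = h (⊨-transfer (agrees-sym a) φ h′)
⊨-transfer a (φ ∧t ψ) (hφ , hψ) = ⊨-transfer a φ hφ , ⊨-transfer a ψ hψ
⊨-transfer a (φ ∨t ψ) h = ⊎-map (⊨-transfer a φ) (⊨-transfer a ψ) h

module _ {nΣ nΓ : ℕ} {T : NRT nΣ nΓ} {x : ω-Word (Fin nΣ × Data)} (ρ : Run T x) where

  output-extends : ∀ {n n′} → n ≤′ n′ → Σ (List (Fin nΓ × Data)) λ e → outUpTo ρ n′ ≡ outUpTo ρ n ++ e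
  output-extends (≤′-reflexive refl) = [] , sym (++-identityʳ _)
  output-extends {n} (≤′-step {n′} n≤n′) =
    let (e , eq) = output-extends n≤n′ in
    e ++ _ , trans (cong (_++ _) eq) (++-assoc (outUpTo ρ n) e _)

  output-consistent : ∀ n n′ {j a b} → outUpTo ρ n ! j ≡ just a → outUpTo ρ n′ ! j ≡ just b → a ≡ b
  output-consistent n n′ {j} ha hb with ≤-total n n′
  ... | inj₁ n≤n′ = let (e , eq) = output-extends (≤⇒≤′ n≤n′) in
        just-injective (trans (sym (!-++ (outUpTo ρ n) e ha)) (trans (cong (_! j) (sym eq)) hb))
  ... | inj₂ n′≤n = let (e , eq) = output-extends (≤⇒≤′ n′≤n) in
        just-injective (trans (sym ha) (trans (cong (_! j) eq) (!-++ (outUpTo ρ n′) e hb)))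

  -- Under the standing assumption an accepting run has an infinite output:
  -- its k-th letter is read off any finite output longer than k.
  outputWord : ∀ {d₀} → InfiniteOutputs T d₀ → Accepting T d₀ ρ → Σ (ω-Word (Fin nΓ × Data)) (OutputOf T ρ)
  outputWord infOut acc = w , isOutput
    where
    long : ∀ k → Σ ℕ λ n → suc k ≤ length (outUpTo ρ n)
    long k = infOut x ρ acc (suc k)
    w : ω-Word (Fin nΓ × Data)
    w k = lookup (outUpTo ρ (proj₁ (long k))) (fromℕ< (proj₂ (long k)))
    w-defined : ∀ k → outUpTo ρ (proj₁ (long k)) ! k ≡ just (w k)
    w-defined k = subst (λ j → outUpTo ρ (proj₁ (long k)) ! j ≡ just (w k))
                        (toℕ-fromℕ< (proj₂ (long k))) (!-lookup (outUpTo ρ (proj₁ (long k))) (fromℕ< (proj₂ (long k))))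
    isOutput : OutputOf T ρ w
    isOutput n i = output-consistent (proj₁ (long (toℕ i))) n (w-defined (toℕ i)) (!-lookup (outUpTo ρ n) i)

cannotCoverAll : ∀ {n} (f : Fin n → ℕ) m → ¬ (∀ (k : Fin (suc n)) → Σ (Fin n) λ r → f r ≡ m + toℕ k)
cannotCoverAll f m hit with i , j , i<j , same ← pigeonhole (n<1+n _) (λ k → proj₁ (hit k)) =
  <⇒≢ i<j (+-cancelˡ-≡ m _ _ (begin
    m + toℕ i         ≡⟨ proj₂ (hit i) ⟨
    f (proj₁ (hit i)) ≡⟨ cong f same ⟩
    f (proj₁ (hit j)) ≡⟨ proj₂ (hit j) ⟩
    m + toℕ j         ∎))
  where open ≡-Reasoning

missedValue : ∀ {n} (f : Fin n → ℕ) m → Σ (Fin (suc n)) λ k → ∀ r → f r ≢ m + toℕ k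
missedValue f m with anyFin? (λ k → ¬? (anyFin? λ r → f r ≟ m + toℕ k))
... | yes (k , unhit) = k , λ r hit → unhit (r , hit)
... | no allHit = ⊥-elim (cannotCoverAll f m λ k →
                    decidable-stable (anyFin? λ r → f r ≟ m + toℕ k) (λ unhit → allHit (k , unhit)))

-- Renaming data values while fixing all values below a threshold M: every
-- run can be turned into one with the same control behaviour whose data
-- values all lie below K = M + nR + 1 (values ≥ M are replaced by fresh values
-- in [M, K), of which there are enough since only nR values are stored).
module Renaming {nΣ nΓ : ℕ} (T : NRT nΣ nΓ) (M : ℕ) where
  open NRT T using (nR)

  K : ℕ
  K = suc (M + nR)

  M≤K : M ≤ K
  M≤K = m≤n⇒m≤1+n (m≤m+n M nR)

  record Renames (d d′ : Data) : Set where
    field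
      fixes : d < M → d′ ≡ d
      large : M ≤ d → M ≤ d′

  renames-compare : ∀ {d d′ b} → Renames d d′ → b < M → (d ≡ b → d′ ≡ b) × (d′ ≡ b → d ≡ b)
  renames-compare {d} {d′} {b} ren b<M = to , from
    where
    open Renames ren
    to : d ≡ b → d′ ≡ b
    to refl = fixes b<M
    from : d′ ≡ b → d ≡ b
    from refl with d <? M
    ... | yes d<M = sym (fixes d<M)
    ... | no d≮M = ⊥-elim (<⇒≱ b<M (large (≮⇒≥ d≮M)))

  record RegsRenamed (τ τ′ : Valuation nR) : Set where
    field
      renames : ∀ r → Renames (τ r) (τ′ r)
      agrees  : ∀ r → Agrees τ τ′ (τ r) (τ′ r)
      bounded : ∀ r → τ′ r < K

  record DataRenamed (τ τ′ : Valuation nR) (d d′ : Data) : Set where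
    field
      renames : Renames d d′
      agrees  : Agrees τ τ′ d d′
      bounded : d′ < K

  regsRenamed-cong : ∀ {τ₁ τ₂ τ′} → (∀ r → τ₁ r ≡ τ₂ r) → RegsRenamed τ₁ τ′ → RegsRenamed τ₂ τ′
  regsRenamed-cong {τ₁} {τ₂} {τ′} τ₁≗τ₂ inv = record
    { renames = λ r → subst (λ d → Renames d (τ′ r)) (τ₁≗τ₂ r) (renames r)
    ; agrees = λ r → record
        { forth = λ r′ e → forth (agrees r) r′ (trans (τ₁≗τ₂ r′) (trans e (sym (τ₁≗τ₂ r))))
        ; back = λ r′ e → trans (sym (τ₁≗τ₂ r′)) (trans (back (agrees r) r′ e) (τ₁≗τ₂ r)) }
    ; bounded = bounded }
    where open RegsRenamed inv

  renameData : Valuation nR → Valuation nR → Data → Data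
  renameData τ τ′ d with anyFin? (λ r → τ r ≟ d)
  ... | yes (r , _) = τ′ r
  ... | no _ with d <? M
  ... | yes _ = d
  ... | no _ = M + toℕ (proj₁ (missedValue τ′ M))

  renameData-ok : ∀ τ τ′ d → RegsRenamed τ τ′ → DataRenamed τ τ′ d (renameData τ τ′ d)
  renameData-ok τ τ′ d inv with anyFin? (λ r → τ r ≟ d)
  ... | yes (r , refl) = record { renames = renames r ; agrees = agrees r ; bounded = bounded r }
    where open RegsRenamed inv
  ... | no unstored with d <? M
  ... | yes d<M = record
    { renames = record { fixes = λ _ → refl ; large = λ M≤d → ⊥-elim (<⇒≱ d<M M≤d) }
    ; agrees = record { forth = λ r e → ⊥-elim (unstored (r , e)) ; back = λ r e → ⊥-elim (unhit r e) }
    ; bounded = ≤-trans d<M M≤K }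
    where
    open RegsRenamed inv
    unhit : ∀ r → τ′ r ≢ d
    unhit r e = unstored (r , proj₂ (renames-compare (renames r) d<M) e)
  ... | no d≮M = record
    { renames = record { fixes = λ d<M → ⊥-elim (d≮M d<M) ; large = λ _ → m≤m+n M _ }
    ; agrees = record { forth = λ r e → ⊥-elim (unstored (r , e)) ; back = λ r e → ⊥-elim (proj₂ fresh r e) }
    ; bounded = s≤s (+-monoʳ-≤ M (≤-pred (toℕ<n (proj₁ fresh)))) }
    where
    fresh : Σ (Fin (suc nR)) λ k → ∀ r → τ′ r ≢ M + toℕ k
    fresh = missedValue τ′ M

  agrees-update : ∀ {τ τ′ d d′ e e′} a → Agrees τ τ′ e e′ →
                  (d ≡ e → d′ ≡ e′) → (d′ ≡ e′ → d ≡ e) →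
                  Agrees (update T a τ d) (update T a τ′ d′) e e′
  agrees-update {τ} {τ′} {d} {d′} {e} {e′} a old to from = record { forth = forth′ ; back = back′ }
    where
    forth′ : ∀ r → update T a τ d r ≡ e → update T a τ′ d′ r ≡ e′
    forth′ r with a r
    ... | true = to
    ... | false = forth old r
    back′ : ∀ r → update T a τ′ d′ r ≡ e′ → update T a τ d r ≡ e
    back′ r with a r
    ... | true = from
    ... | false = back old r

  update-renamed : ∀ {τ τ′ d d′} a → RegsRenamed τ τ′ → DataRenamed τ τ′ d d′ →
                   RegsRenamed (update T a τ d) (update T a τ′ d′)
  update-renamed {τ} {τ′} {d} {d′} a inv dat = record { renames = renames′ ; agrees = agrees′ ; bounded = bounded′ }
    where
    open RegsRenamed inv
    renames′ : ∀ r → Renames (update T a τ d r) (update T a τ′ d′ r)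
    renames′ r with a r
    ... | true = DataRenamed.renames dat
    ... | false = renames r
    agrees′ : ∀ r → Agrees (update T a τ d) (update T a τ′ d′) (update T a τ d r) (update T a τ′ d′ r)
    agrees′ r with a r
    ... | true = agrees-update a (DataRenamed.agrees dat) (λ _ → refl) (λ _ → refl)
    ... | false = agrees-update a (agrees r)
                    (λ e → sym (forth (DataRenamed.agrees dat) r (sym e)))
                    (λ e → sym (back (DataRenamed.agrees dat) r (sym e)))
    bounded′ : ∀ r → update T a τ′ d′ r < K
    bounded′ r with a r
    ... | true = DataRenamed.bounded dat
    ... | false = bounded r

  module RenamedRun {d₀} (d₀<M : d₀ < M) {x : ω-Word (Fin nΣ × Data)} (ρ : Run T x) (acc : Accepting T d₀ ρ) where
    regs′ : ℕ → Valuation nR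
    data′ : ℕ → Data

    regs′ zero = λ _ → d₀
    regs′ (suc i) = update T (Transition.asgn (tr ρ i)) (regs′ i) (data′ i)

    data′ i = renameData (regs ρ i) (regs′ i) (proj₂ (x i))

    regs-renamed : ∀ i → RegsRenamed (regs ρ i) (regs′ i)
    data-renamed : ∀ i → DataRenamed (regs ρ i) (regs′ i) (proj₂ (x i)) (data′ i)

    regs-renamed zero = regsRenamed-cong (λ r → sym (proj₁ (proj₂ acc) r)) record
      { renames = λ r → record { fixes = λ _ → refl ; large = λ M≤d₀ → M≤d₀ }
      ; agrees = λ r → record { forth = λ _ _ → refl ; back = λ _ _ → refl }
      ; bounded = λ r → ≤-trans d₀<M M≤K }
    regs-renamed (suc i) = regsRenamed-cong (λ r → sym (upd ρ i r))
      (update-renamed _ (regs-renamed i) (data-renamed i))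

    data-renamed i = renameData-ok (regs ρ i) (regs′ i) (proj₂ (x i)) (regs-renamed i)

    x′ : ω-Word (Fin nΣ × Data)
    x′ i = proj₁ (x i) , data′ i

    ρ′ : Run T x′
    ρ′ = record
      { state = state ρ ; regs = regs′ ; tr = tr ρ ; tr∈Δ = tr∈Δ ρ
      ; src≡ = src≡ ρ ; tgt≡ = tgt≡ ρ ; lab≡ = lab≡ ρ
      ; sat = λ i → ⊨-transfer (DataRenamed.agrees (data-renamed i)) _ (sat ρ i)
      ; upd = λ i r → refl }

    acc′ : Accepting T d₀ ρ′
    acc′ = proj₁ acc , (λ r → refl) , proj₂ (proj₂ acc)

clamp : ∀ n → ℕ → Fin (suc n)
clamp n k = fromℕ< (s≤s (m⊓n≤n k n))

toℕ-clamp : ∀ {n k} → k ≤ n → toℕ (clamp n k) ≡ k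
toℕ-clamp {n} {k} k≤n = trans (toℕ-fromℕ< (s≤s (m⊓n≤n k n))) (m≤n⇒m⊓n≡m k≤n)

-- After i steps, i ⊓ L letters of a word of length L have been read; one
-- more step updates this count as follows.
⊓-suc : ∀ i L → suc (i ⊓ L) ⊓ L ≡ suc i ⊓ L
⊓-suc i L = begin
  (suc i ⊓ suc L) ⊓ L ≡⟨ ⊓-assoc (suc i) (suc L) L ⟩
  suc i ⊓ (suc L ⊓ L) ≡⟨ cong (suc i ⊓_) (m≥n⇒m⊓n≡n (n≤1+n L)) ⟩
  suc i ⊓ L           ∎
  where open ≡-Reasoning

⊓-below : ∀ i L → i ⊓ L < L → i < L
⊓-below i L i⊓L<L with i <? L
... | yes i<L = i<L
... | no i≮L = ⊥-elim (<-irrefl (m≥n⇒m⊓n≡n (≮⇒≥ i≮L)) i⊓L<L)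

_≟ℓ_ : ∀ {n} → DecidableEquality (Fin n × Data)
_≟ℓ_ = ≡-dec× _≟F_ _≟_

allVecs : ∀ k n → List (Vec (Fin k) n)
allVecs k zero = []ᵛ ∷ []
allVecs k (suc n) = cartesianProductWith _∷ᵛ_ (allFin k) (allVecs k n)

∈-allVecs : ∀ {k n} (τ : Vec (Fin k) n) → τ ∈ allVecs k n
∈-allVecs []ᵛ = here refl
∈-allVecs (a ∷ᵛ τ) = ∈-cartesianProductWith⁺ _∷ᵛ_ (∈-allFin a) (∈-allVecs τ)

module Counterexamples (d₀ : Data) {nΣ nΓ : ℕ} (T : NRT nΣ nΓ)
                       (u : List (Fin nΣ × Data)) (v : List (Fin nΓ × Data)) where
  open NRT T

  -- every data value mentioned by d₀, u or v is below M
  M : ℕ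
  M = suc (d₀ + dataSum u + dataSum v)

  d₀<M : d₀ < M
  d₀<M = s≤s (≤-trans (m≤m+n d₀ (dataSum u)) (m≤m+n _ (dataSum v)))

  u-small : ∀ {j a} → u ! j ≡ just a → proj₂ a < M
  u-small e = s≤s (≤-trans (≤-trans (!-dataSum u e) (m≤n+m (dataSum u) d₀)) (m≤m+n _ (dataSum v)))

  v-small : ∀ {j a} → v ! j ≡ just a → proj₂ a < M
  v-small e = s≤s (≤-trans (!-dataSum v e) (m≤n+m (dataSum v) _))

  open Renaming T M
  open PrefixChecker _≟ℓ_ v

  L : ℕ
  L = length u

  -- A node records how much of u has been read, the prefix checker's state,
  -- the control state and the register contents, all data being below K.
  Regs : Set
  Regs = Vec (Fin K) nR

  Node : Set
  Node = Fin (suc L) × Fin (suc rejected) × Fin nQ × Regs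

  position : Node → Fin (suc L)
  position (p , c , q , τ) = p

  checkState : Node → Fin (suc rejected)
  checkState (p , c , q , τ) = c

  control : Node → Fin nQ
  control (p , c , q , τ) = q

  registers : Node → Regs
  registers (p , c , q , τ) = τ

  value : Regs → Valuation nR
  value τ r = toℕ (lookupᵛ τ r)

  assign : (Fin nR → Bool) → Regs → Fin K → Regs
  assign a τ d = tabulate λ r → if a r then d else lookupᵛ τ r

  value-assign : ∀ a τ d r → value (assign a τ d) r ≡ update T a (value τ) (toℕ d) r
  value-assign a τ d r = trans (cong toℕ (lookup∘tabulate _ r)) (if-float toℕ (a r))

  record Step (s s′ : Node) (σ : Fin nΣ) (d : Fin K) (t : Transition nΣ nΓ nQ nR) : Set where
    field
      from-state : Transition.src t ≡ control s
      to-state   : Transition.tgt t ≡ control s′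
      reads      : Transition.lab t ≡ σ
      guard      : value (registers s) , toℕ d ⊨ Transition.test t
      assigns    : registers s′ ≡ assign (Transition.asgn t) (registers s) d
      advances   : toℕ (position s′) ≡ suc (toℕ (position s)) ⊓ L
      follows-u  : toℕ (position s) < L → u ! toℕ (position s) ≡ just (σ , toℕ d)
      checks     : toℕ (checkState s′) ≡
                   foldl scan (toℕ (checkState s)) (evalOut T (Transition.out t) (value (registers s′)))

  step? : ∀ s s′ σ d t → Dec (Step s s′ σ d t)
  step? s s′ σ d t = map′
    (λ (a , b , c , e , f , g , h , k) → record
       { from-state = a ; to-state = b ; reads = c ; guard = e ; assigns = f ; advances = g ; follows-u = h ; checks = k })
    (λ st → let open Step st in from-state , to-state , reads , guard , assigns , advances , follows-u , checks)
    ((Transition.src t ≟F control s) ×-dec (Transition.tgt t ≟F control s′) ×-dec (Transition.lab t ≟F σ) ×-dec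
     ⊨? (value (registers s)) (toℕ d) (Transition.test t) ×-dec
     ≡-decVec _≟F_ (registers s′) (assign (Transition.asgn t) (registers s) d) ×-dec
     (toℕ (position s′) ≟ suc (toℕ (position s)) ⊓ L) ×-dec
     ((toℕ (position s) <? L) →-dec ≡-decMaybe _≟ℓ_ (u ! toℕ (position s)) (just (σ , toℕ d))) ×-dec
     (toℕ (checkState s′) ≟ foldl scan (toℕ (checkState s)) (evalOut T (Transition.out t) (value (registers s′)))))

  Edge : Node → Node → Set
  Edge s s′ = Σ (Fin nΣ) λ σ → Σ (Fin K) λ d → Any (Step s s′ σ d) Δ

  edge? : ∀ s s′ → Dec (Edge s s′)
  edge? s s′ = anyFin? λ σ → anyFin? λ d → any? (step? s s′ σ d) Δ

  -- accepting for T, and a conflict with v has been seen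
  Final : Node → Set
  Final s = F (control s) ≡ true × toℕ (checkState s) ≡ rejected

  final? : ∀ s → Dec (Final s)
  final? s = (F (control s) ≟B true) ×-dec (toℕ (checkState s) ≟ rejected)

  start : Node
  start = fzero , fzero , i₀ , tabulate (λ _ → clamp (M + nR) d₀)

  nodes : List Node
  nodes = cartesianProduct (allFin _) (cartesianProduct (allFin _) (cartesianProduct (allFin _) (allVecs K nR)))

  ∈-nodes : ∀ s → s ∈ nodes
  ∈-nodes (p , c , q , τ) =
    ∈-cartesianProduct⁺ (∈-allFin p) (∈-cartesianProduct⁺ (∈-allFin c) (∈-cartesianProduct⁺ (∈-allFin q) (∈-allVecs τ)))

  _≟ᴺ_ : DecidableEquality Node
  _≟ᴺ_ = ≡-dec× _≟F_ (≡-dec× _≟F_ (≡-dec× _≟F_ (≡-decVec _≟F_)))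

  open BuchiEmptiness _≟ᴺ_ nodes ∈-nodes Edge edge? Final final? start public

  rejection-persists : ∀ {x} (ρ : Run T x) {n m} → n ≤ m → check (outUpTo ρ n) ≡ rejected →
                       check (outUpTo ρ m) ≡ rejected
  rejection-persists ρ {n} {m} n≤m rej = let (e , eq) = output-extends ρ (≤⇒≤′ n≤m) in begin
    check (outUpTo ρ m)                ≡⟨ cong check eq ⟩
    check (outUpTo ρ n ++ e)           ≡⟨ foldl-++ scan 0 (outUpTo ρ n) e ⟩
    foldl scan (check (outUpTo ρ n)) e ≡⟨ cong (λ c → foldl scan c e) rej ⟩
    foldl scan rejected e              ≡⟨ rejected-absorbing e ⟩
    rejected                           ∎
    where open ≡-Reasoning

  module FromBuchiRun (run : BuchiRun) where
    open BuchiRun run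

    letter : ℕ → Fin nΣ
    letter i = proj₁ (steps i)

    datum : ℕ → Fin K
    datum i = proj₁ (proj₂ (steps i))

    transition : ℕ → Transition nΣ nΓ nQ nR
    transition i = proj₁ (find (proj₂ (proj₂ (steps i))))

    transition∈Δ : ∀ i → transition i ∈ Δ
    transition∈Δ i = proj₁ (proj₂ (find (proj₂ (proj₂ (steps i)))))

    stepAt : ∀ i → Step (node i) (node (suc i)) (letter i) (datum i) (transition i)
    stepAt i = proj₂ (proj₂ (find (proj₂ (proj₂ (steps i)))))

    x : ω-Word (Fin nΣ × Data)
    x i = letter i , toℕ (datum i)

    ρ : Run T x
    ρ = record
      { state = λ i → control (node i) ; regs = λ i → value (registers (node i))
      ; tr = transition ; tr∈Δ = transition∈Δ
      ; src≡ = λ i → Step.from-state (stepAt i) ; tgt≡ = λ i → Step.to-state (stepAt i)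
      ; lab≡ = λ i → Step.reads (stepAt i) ; sat = λ i → Step.guard (stepAt i)
      ; upd = λ i r → trans (cong (λ τ → value τ r) (Step.assigns (stepAt i)))
                            (value-assign (Transition.asgn (transition i)) (registers (node i)) (datum i) r) }

    accepting : Accepting T d₀ ρ
    accepting = cong control starts ,
                (λ r → trans (cong (λ s → value (registers s) r) starts)
                             (trans (cong toℕ (lookup∘tabulate _ r)) (toℕ-clamp (≤-pred (≤-trans d₀<M M≤K))))) ,
                (λ n → let (m , n≤m , fin) = recurrent n in m , n≤m , proj₁ fin)

    position-at : ∀ i → toℕ (position (node i)) ≡ i ⊓ L
    position-at zero = cong (λ s → toℕ (position s)) starts
    position-at (suc i) = trans (Step.advances (stepAt i)) (trans (cong (λ p → suc p ⊓ L) (position-at i)) (⊓-suc i L))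

    u⪯x : u ⪯ x
    u⪯x k = just-injective (begin
      just (x (toℕ k))                  ≡⟨ Step.follows-u (stepAt (toℕ k)) (subst (_< L) (sym at-k) (toℕ<n k)) ⟨
      u ! toℕ (position (node (toℕ k))) ≡⟨ cong (u !_) at-k ⟩
      u ! toℕ k                         ≡⟨ !-lookup u k ⟩
      just (lookup u k)                 ∎)
      where
      open ≡-Reasoning
      at-k : toℕ (position (node (toℕ k))) ≡ toℕ k
      at-k = trans (position-at (toℕ k)) (m≤n⇒m⊓n≡m (<⇒≤ (toℕ<n k)))

    checkState-at : ∀ i → toℕ (checkState (node i)) ≡ check (outUpTo ρ i)
    checkState-at zero = cong (λ s → toℕ (checkState s)) starts
    checkState-at (suc i) = trans (Step.checks (stepAt i))
      (trans (cong (λ c → foldl scan c (evalOut T (Transition.out (transition i)) (regs ρ (suc i)))) (checkState-at i))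
             (sym (foldl-++ scan 0 (outUpTo ρ i) _)))

    rejects : Σ ℕ λ n → check (outUpTo ρ n) ≡ rejected
    rejects = let (m , _ , fin) = recurrent 0 in m , trans (sym (checkState-at m)) (proj₂ fin)

  buchiRun-refutes : InfiniteOutputs T d₀ → BuchiRun → ¬ PrefixOfHat T d₀ u v
  buchiRun-refutes infOut run v⪯f̂u with n , rej ← FromBuchiRun.rejects run
    with j , a , b , out-j , v-j , a≢b ← rejected⇒conflict (outUpTo (FromBuchiRun.ρ run) n) 0 z≤n rej
    = a≢b (trans (sym w-j≡a) w-j≡b)
    where
    open FromBuchiRun run
    output : Σ (ω-Word (Fin nΓ × Data)) (OutputOf T ρ)
    output = outputWord ρ infOut accepting
    w : ω-Word (Fin nΓ × Data)
    w = proj₁ output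
    w-j≡a : w j ≡ a
    w-j≡a = let (k , k≡j , out-k) = !-just (outUpTo ρ n) out-j in
      trans (cong w (sym k≡j)) (trans (proj₂ output n k) out-k)
    w-j≡b : w j ≡ b
    w-j≡b = let (k , k≡j , v-k) = !-just v v-j in
      trans (cong w (sym (trans k≡j (+-identityʳ j))))
            (trans (v⪯f̂u x w (ρ , accepting , proj₂ output) u⪯x k) v-k)

  module ToBuchiRun {x : ω-Word (Fin nΣ × Data)} (ρ : Run T x) (acc : Accepting T d₀ ρ) (u⪯x : u ⪯ x)
                    (regs-small : ∀ i r → regs ρ i r < K) (data-small : ∀ i → proj₂ (x i) < K)
                    (n₀ : ℕ) (rej : check (outUpTo ρ n₀) ≡ rejected) where
    -- the node after i steps; clamping loses nothing since all data are below K
    datum : ℕ → Fin K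
    datum i = clamp (M + nR) (proj₂ (x i))

    node : ℕ → Node
    node i = clamp L (i ⊓ L) , clamp rejected (check (outUpTo ρ i)) , state ρ i ,
             tabulate (λ r → clamp (M + nR) (regs ρ i r))

    datum-value : ∀ i → toℕ (datum i) ≡ proj₂ (x i)
    datum-value i = toℕ-clamp (≤-pred (data-small i))

    value-at : ∀ i r → value (registers (node i)) r ≡ regs ρ i r
    value-at i r = trans (cong toℕ (lookup∘tabulate _ r)) (toℕ-clamp (≤-pred (regs-small i r)))

    position-at : ∀ i → toℕ (position (node i)) ≡ i ⊓ L
    position-at i = toℕ-clamp (m⊓n≤n i L)

    checkState-at : ∀ i → toℕ (checkState (node i)) ≡ check (outUpTo ρ i)
    checkState-at i = toℕ-clamp (state-bounded 0 (outUpTo ρ i) z≤n)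

    reads-u : ∀ i → i < L → u ! i ≡ just (x i)
    reads-u i i<L = begin
      u ! i                        ≡⟨ cong (u !_) (toℕ-fromℕ< i<L) ⟨
      u ! toℕ (fromℕ< i<L)         ≡⟨ !-lookup u (fromℕ< i<L) ⟩
      just (lookup u (fromℕ< i<L)) ≡⟨ cong just (u⪯x (fromℕ< i<L)) ⟨
      just (x (toℕ (fromℕ< i<L)))  ≡⟨ cong (λ j → just (x j)) (toℕ-fromℕ< i<L) ⟩
      just (x i)                   ∎
      where open ≡-Reasoning

    stepAt : ∀ i → Step (node i) (node (suc i)) (proj₁ (x i)) (datum i) (tr ρ i)
    stepAt i = record
      { from-state = src≡ ρ i ; to-state = tgt≡ ρ i ; reads = lab≡ ρ i
      ; guard = ⊨-transfer (agrees-≗ (λ r → sym (value-at i r)) (sym (datum-value i))) _ (sat ρ i)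
      ; assigns = tabulate-cong assigns
      ; advances = trans (position-at (suc i)) (trans (sym (⊓-suc i L)) (cong (λ p → suc p ⊓ L) (sym (position-at i))))
      ; follows-u = follows-u
      ; checks = checks }
      where
      open ≡-Reasoning
      a : Fin nR → Bool
      a = Transition.asgn (tr ρ i)
      o : List (Fin nΓ × Fin nR)
      o = Transition.out (tr ρ i)

      assigns : ∀ r → clamp (M + nR) (regs ρ (suc i) r) ≡ (if a r then datum i else lookupᵛ (registers (node i)) r)
      assigns r = begin
        clamp (M + nR) (regs ρ (suc i) r)                              ≡⟨ cong (clamp (M + nR)) (upd ρ i r) ⟩
        clamp (M + nR) (if a r then proj₂ (x i) else regs ρ i r)       ≡⟨ if-float (clamp (M + nR)) (a r) ⟩
        (if a r then datum i else clamp (M + nR) (regs ρ i r))         ≡⟨ cong (if a r then datum i else_) (lookup∘tabulate _ r) ⟨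
        (if a r then datum i else lookupᵛ (registers (node i)) r)      ∎

      follows-u : toℕ (position (node i)) < L → u ! toℕ (position (node i)) ≡ just (proj₁ (x i) , toℕ (datum i))
      follows-u p<L = begin
        u ! toℕ (position (node i))         ≡⟨ cong (u !_) (trans (position-at i) (m≤n⇒m⊓n≡m (<⇒≤ i<L))) ⟩
        u ! i                               ≡⟨ reads-u i i<L ⟩
        just (x i)                          ≡⟨ cong (λ d → just (proj₁ (x i) , d)) (datum-value i) ⟨
        just (proj₁ (x i) , toℕ (datum i))  ∎
        where
        i<L : i < L
        i<L = ⊓-below i L (subst (_< L) (position-at i) p<L)

      checks : toℕ (checkState (node (suc i))) ≡
               foldl scan (toℕ (checkState (node i))) (evalOut T o (value (registers (node (suc i)))))
      checks = begin
        toℕ (checkState (node (suc i)))                         ≡⟨ checkState-at (suc i) ⟩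
        check (outUpTo ρ i ++ evalOut T o (regs ρ (suc i)))     ≡⟨ foldl-++ scan 0 (outUpTo ρ i) _ ⟩
        foldl scan (check (outUpTo ρ i)) (evalOut T o (regs ρ (suc i)))
          ≡⟨ cong₂ (foldl scan) (sym (checkState-at i))
                   (map-cong (λ p → cong (proj₁ p ,_) (sym (value-at (suc i) (proj₂ p)))) o) ⟩
        foldl scan (toℕ (checkState (node i))) (evalOut T o (value (registers (node (suc i))))) ∎

    -- final nodes recur: T accepts infinitely often and rejection persists
    buchiRun : BuchiRun
    buchiRun = record
      { node = node
      ; starts = cong₂ (λ q τ → fzero , fzero , q , τ) (proj₁ acc) (tabulate-cong λ r → cong (clamp (M + nR)) (proj₁ (proj₂ acc) r))
      ; steps = λ i → proj₁ (x i) , datum i , lose (tr∈Δ ρ i) (stepAt i)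
      ; recurrent = recurrent }
      where
      recurrent : ∀ n → Σ ℕ λ m → n ≤ m × Final (node m)
      recurrent n = let (m , n⊔n₀≤m , F-m) = proj₂ (proj₂ acc) (n ⊔ n₀) in
        m , ≤-trans (m≤m⊔n n n₀) n⊔n₀≤m , F-m ,
        trans (checkState-at m) (rejection-persists ρ (≤-trans (m≤n⊔m n n₀) n⊔n₀≤m) rej)

  conflict⇒rejection : InfiniteOutputs T d₀ → ∀ {x w} (ρ : Run T x) → Accepting T d₀ ρ → OutputOf T ρ w →
                       (k : Fin (length v)) → w (toℕ k) ≢ lookup v k → Σ ℕ λ n → check (outUpTo ρ n) ≡ rejected
  conflict⇒rejection infOut {x} {w} ρ acc isOut k w≢v =
    n , conflict⇒rejected (outUpTo ρ n) 0 (toℕ k) out-k v-k w≢v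
    where
    open ≡-Reasoning
    n : ℕ
    n = proj₁ (infOut x ρ acc (suc (toℕ k)))
    i : Fin (length (outUpTo ρ n))
    i = fromℕ< (proj₂ (infOut x ρ acc (suc (toℕ k))))
    i≡k : toℕ i ≡ toℕ k
    i≡k = toℕ-fromℕ< _
    out-k : outUpTo ρ n ! toℕ k ≡ just (w (toℕ k))
    out-k = begin
      outUpTo ρ n ! toℕ k              ≡⟨ cong (outUpTo ρ n !_) i≡k ⟨
      outUpTo ρ n ! toℕ i              ≡⟨ !-lookup (outUpTo ρ n) i ⟩
      just (lookup (outUpTo ρ n) i)    ≡⟨ cong just (isOut n i) ⟨
      just (w (toℕ i))                 ≡⟨ cong (λ j → just (w j)) i≡k ⟩
      just (w (toℕ k))                 ∎
    v-k : v ! (toℕ k + 0) ≡ just (lookup v k)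
    v-k = trans (cong (v !_) (+-identityʳ (toℕ k))) (!-lookup v k)

  renamed-indistinguishable : ∀ {γ d d′} → Renames d d′ → Indistinguishable (γ , d) (γ , d′)
  renamed-indistinguishable ren vb = let (to , from) = renames-compare ren (v-small vb) in
    (λ eq → cong₂ _,_ (cong proj₁ eq) (to (cong proj₂ eq))) ,
    (λ eq → cong₂ _,_ (cong proj₁ eq) (from (cong proj₂ eq)))

  module RenamedCounterexample {x : ω-Word (Fin nΣ × Data)} (ρ : Run T x) (acc : Accepting T d₀ ρ) where
    open RenamedRun d₀<M ρ acc public

    u⪯x′ : u ⪯ x → u ⪯ x′
    u⪯x′ u⪯x k = trans (cong (proj₁ (x (toℕ k)) ,_) (Renames.fixes (DataRenamed.renames (data-renamed (toℕ k))) small))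
                       (u⪯x k)
      where
      small : proj₂ (x (toℕ k)) < M
      small = subst (λ a → proj₂ a < M) (sym (u⪯x k)) (u-small (!-lookup u k))

    check-renamed : ∀ n → check (outUpTo ρ′ n) ≡ check (outUpTo ρ n)
    check-renamed zero = refl
    check-renamed (suc n) = begin
      check (outUpTo ρ′ n ++ evalOut T o (regs′ (suc n)))               ≡⟨ foldl-++ scan 0 (outUpTo ρ′ n) _ ⟩
      foldl scan (check (outUpTo ρ′ n)) (evalOut T o (regs′ (suc n)))   ≡⟨ cong (λ c → foldl scan c (evalOut T o (regs′ (suc n)))) (check-renamed n) ⟩
      foldl scan (check (outUpTo ρ n)) (evalOut T o (regs′ (suc n)))
        ≡⟨ run-respects _ _ (λ p → renamed-indistinguishable (RegsRenamed.renames (regs-renamed (suc n)) (proj₂ p))) _ o ⟨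
      foldl scan (check (outUpTo ρ n)) (evalOut T o (regs ρ (suc n)))   ≡⟨ foldl-++ scan 0 (outUpTo ρ n) _ ⟨
      check (outUpTo ρ n ++ evalOut T o (regs ρ (suc n)))               ∎
      where
      open ≡-Reasoning
      o : List (Fin nΓ × Fin nR)
      o = Transition.out (tr ρ n)

  conflict⇒buchiRun : InfiniteOutputs T d₀ → ∀ {x w} → Rel T d₀ x w → u ⪯ x →
                      (k : Fin (length v)) → w (toℕ k) ≢ lookup v k → BuchiRun
  conflict⇒buchiRun infOut {w = w} (ρ , acc , isOut) u⪯x k w≢v
    with n , rej ← conflict⇒rejection infOut {w = w} ρ acc isOut k w≢v
    = ToBuchiRun.buchiRun ρ′ acc′ (u⪯x′ u⪯x)
        (λ i r → RegsRenamed.bounded (regs-renamed i) r) (λ i → DataRenamed.bounded (data-renamed i))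
        n (trans (check-renamed n) rej)
    where open RenamedCounterexample ρ acc

lemma3 : (d₀ : Data) {nΣ nΓ : ℕ} (T : NRT nΣ nΓ) →
         InfiniteOutputs T d₀ → Functional T d₀ →
         (u : List (Fin nΣ × Data)) → PrefixOfDom T d₀ u →
         (v : List (Fin nΓ × Data)) →
         Dec (PrefixOfHat T d₀ u v)
lemma3 d₀ T infOut _ u _ v = decide buchi?
  where
  open Counterexamples d₀ T u v
  -- a Büchi run refutes v ⪯ f̂(u); without one, no position of v can conflict
  decide : Dec BuchiRun → Dec (PrefixOfHat T d₀ u v)
  decide (yes run) = no (buchiRun-refutes infOut run)
  decide (no noRun) = yes λ x w rel u⪯x k →
    decidable-stable (w (toℕ k) ≟ℓ lookup v k) (λ w≢v → noRun (conflict⇒buchiRun infOut {w = w} rel u⪯x k w≢v))
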